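{- Let $\mathcal{C}\subseteq\mathbb{N}^d$ be a positive integer cone and let $k\in\mathcal{C}$. If $|\operatorname{I}_{\mathcal{C}}(k)|$ is odd, then $\frac{k}{2}\in\mathcal{C}$.
   Context: For a finite $A\subseteq\mathbb{N}^d$, the positive integer cone spanned by $A$ is $\mathcal{C}=\{\sum q_ia_i: a_i\in A, q_i\in\mathbb{Q}_{\geq0}\}\cap\mathbb{N}^d$. $x\leq_{\mathcal{C}}y$ iff $y-x\in\mathcal{C}$; $\operatorname{I}_{\mathcal{C}}(k)=\{x\in\mathcal{C}: x\leq_{\mathcal{C}}k\}$. -}

module Defs where

open import Data.Nat using (ℕ; zero; suc) renaming (_+_ to _+ℕ_; _*_ to _*ℕ_)
open import Data.Integer using (+_)
open import Data.Fin using (Fin; zero; suc)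
open import Data.Vec using (Vec; lookup; zipWith)
open import Data.Rational using (ℚ; 0ℚ; _+_; _*_; _≤_; _/_)
open import Data.Product using (Σ; _×_)
open import Relation.Binary.PropositionalEquality using (_≡_)

toℚ : ℕ → ℚ
toℚ n = (+ n) / 1

Σℚ : ∀ {m} → (Fin m → ℚ) → ℚ
Σℚ {zero}  f = 0ℚ
Σℚ {suc m} f = f zero + Σℚ (λ i → f (suc i))

-- Membership in the positive integer cone spanned by the finite set
-- A = {A 0, ..., A (m-1)} ⊆ ℕ^d:  x = Σ q_i a_i with q_i ∈ ℚ_{≥0}, x ∈ ℕ^d.
InCone : ∀ {d m} → (Fin m → Vec ℕ d) → Vec ℕ d → Set
InCone {d} {m} A x =
  Σ (Fin m → ℚ) λ q →
    (∀ i → 0ℚ ≤ q i) ×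
    (∀ (j : Fin d) → Σℚ (λ i → q i * toℚ (lookup (A i) j)) ≡ toℚ (lookup x j))

-- x ≤_C y  iff  y - x ∈ C  (y - x taken in ℤ^d; it lies in C ⊆ ℕ^d iff
-- there is z ∈ C with x + z = y)
_≤[_]_ : ∀ {d m} → Vec ℕ d → (Fin m → Vec ℕ d) → Vec ℕ d → Set
x ≤[ A ] y = Σ (Vec ℕ _) λ z → InCone A z × (zipWith _+ℕ_ x z ≡ y)

InI : ∀ {d m} → (Fin m → Vec ℕ d) → Vec ℕ d → Vec ℕ d → Set
InI A k x = InCone A x × (x ≤[ A ] k)

{-# OPTIONS --safe #-}
-- The reflection x ↦ k − x maps I_C(k) to itself: if x ≤_C k then k − x ∈ C
-- and k − (k − x) = x ≤_C k.  It is an involution, so I_C(k) splits into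
-- pairs {x, k − x} and fixed points.  An odd count forces a fixed point x,
-- i.e. 2x = k with x ∈ C.
module Submission where

open import Defs
open import Data.Nat using (ℕ; _+_; _∸_; _*_; _<_; suc; _≟_)
open import Data.Nat.Properties using (m+n∸m≡n; +-comm; +-identityʳ; n<1+n; m<n⇒m<1+n; 0≢1+n)
open import Data.Nat.DivMod using (_%_)
open import Data.Nat.Divisibility using (_∣_; _∣0; n∣n; ∣m∣n⇒∣m+n; n∣m⇒m%n≡0)
open import Data.Nat.Induction using (<-wellFounded)
open import Data.Fin using (Fin)
open import Data.Vec using (Vec; []; _∷_; lookup; zipWith)
open import Data.Vec.Properties using (zipWith-comm; lookup-zipWith; ≡-dec)
open import Data.List using (List; []; _∷_; length)
open import Data.List.Properties using (length-removeAt′)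
open import Data.List.Relation.Unary.Any using (here; there; index; any?)
open import Data.List.Relation.Unary.All as All using ()
open import Data.List.Relation.Unary.All.Properties using (─⁺)
open import Data.List.Relation.Unary.AllPairs as AllPairs using ([]; _∷_)
open import Data.List.Membership.Propositional using (_∈_; _∉_; _─_; find; lose)
open import Data.List.Relation.Unary.Unique.Propositional using (Unique)
open import Data.List.Relation.Unary.Unique.Propositional.Properties using (Unique[x∷xs]⇒x∉xs)
open import Data.Product using (Σ; ∃-syntax; _×_; _,_; proj₁)
open import Data.Empty using (⊥-elim)
open import Function.Bundles using (_⇔_; Equivalence)
open import Induction.WellFounded using (Acc; acc)
open import Relation.Nullary using (yes; no)
open import Relation.Binary.Definitions using (DecidableEquality)
open import Relation.Binary.PropositionalEquality
  using (_≡_; _≢_; refl; sym; trans; cong; cong₂; subst; module ≡-Reasoning)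

module _ {a} {A : Set a} where

  ∈-─⁻ : ∀ {x y} {xs : List A} (p : y ∈ xs) → x ∈ xs ─ p → x ∈ xs
  ∈-─⁻ (here _)  x∈       = there x∈
  ∈-─⁻ (there p) (here e)  = here e
  ∈-─⁻ (there p) (there q) = there (∈-─⁻ p q)

  ∈-─⁺ : ∀ {x y} {xs : List A} (p : y ∈ xs) → x ∈ xs → x ≢ y → x ∈ xs ─ p
  ∈-─⁺ (here refl) (here refl) x≢y = ⊥-elim (x≢y refl)
  ∈-─⁺ (here _)    (there q)   _   = q
  ∈-─⁺ (there p)   (here e)    _   = here e
  ∈-─⁺ (there p)   (there q)   x≢y = there (∈-─⁺ p q x≢y)

  Unique-─ : ∀ {y} {xs : List A} → Unique xs → (p : y ∈ xs) → Unique (xs ─ p)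
  Unique-─ (_ ∷ u)    (here _)  = u
  Unique-─ (x≢ ∷ u)   (there p) = ─⁺ p x≢ ∷ Unique-─ u p

  Unique⇒∉-─ : ∀ {y} {xs : List A} → Unique xs → (p : y ∈ xs) → y ∉ xs ─ p
  Unique⇒∉-─ u@(_ ∷ _) (here refl) = Unique[x∷xs]⇒x∉xs u
  Unique⇒∉-─ (x≢ ∷ _)  (there p) (here e)  = All.lookup x≢ p (sym e)
  Unique⇒∉-─ (_ ∷ u)   (there p) (there q) = Unique⇒∉-─ u p q

  record InvolutionOn (σ : A → A) (L : List A) : Set a where
    field
      closed     : ∀ {x} → x ∈ L → σ x ∈ L
      involutive : ∀ {x} → x ∈ L → σ (σ x) ≡ x

    injective : ∀ {x y} → x ∈ L → y ∈ L → σ x ≡ σ y → x ≡ y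
    injective {x} {y} x∈L y∈L σx≡σy = begin
      x         ≡⟨ sym (involutive x∈L) ⟩
      σ (σ x)   ≡⟨ cong σ σx≡σy ⟩
      σ (σ y)   ≡⟨ involutive y∈L ⟩
      y         ∎
      where open ≡-Reasoning

  FixedPointFree : (A → A) → List A → Set a
  FixedPointFree σ L = ∀ {x} → x ∈ L → σ x ≢ x

  module _ {σ : A → A} {x : A} {xs : List A}
           (u : Unique (x ∷ xs)) (inv : InvolutionOn σ (x ∷ xs)) (σx∈xs : σ x ∈ xs) where

    open InvolutionOn inv

    private
      ys : List A
      ys = xs ─ σx∈xs

      ys⊆xs : ∀ {y} → y ∈ ys → y ∈ x ∷ xs
      ys⊆xs y∈ys = there (∈-─⁻ σx∈xs y∈ys)

      -- σ y = x would give y = σ x, which was removed; σ y = σ x would give y = x ∉ xs.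
      closed-─ : ∀ {y} → y ∈ ys → σ y ∈ ys
      closed-─ {y} y∈ys with closed (ys⊆xs y∈ys)
      ... | here σy≡x = ⊥-elim (Unique⇒∉-─ (AllPairs.tail u) σx∈xs (subst (_∈ ys) y≡σx y∈ys))
        where
        y≡σx : y ≡ σ x
        y≡σx = trans (sym (involutive (ys⊆xs y∈ys))) (cong σ σy≡x)
      ... | there σy∈xs = ∈-─⁺ σx∈xs σy∈xs λ σy≡σx →
        Unique[x∷xs]⇒x∉xs u (subst (_∈ xs) (injective (ys⊆xs y∈ys) (here refl) σy≡σx) (∈-─⁻ σx∈xs y∈ys))

    InvolutionOn-─ : InvolutionOn σ ys
    InvolutionOn-─ = record
      { closed     = closed-─
      ; involutive = λ y∈ys → involutive (ys⊆xs y∈ys)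
      }

  fixedPointFree⇒2∣length : ∀ {σ} {L : List A} → Unique L → InvolutionOn σ L →
                            FixedPointFree σ L → 2 ∣ length L
  fixedPointFree⇒2∣length = go (<-wellFounded _)
    where
    go : ∀ {σ} {L : List A} → Acc _<_ (length L) → Unique L →
         InvolutionOn σ L → FixedPointFree σ L → 2 ∣ length L
    go {L = []} _ _ _ _ = 2 ∣0
    go {L = x ∷ xs} (acc rec) u inv fpf with InvolutionOn.closed inv (here refl)
    ... | here σx≡x   = ⊥-elim (fpf (here refl) σx≡x)
    ... | there σx∈xs = subst (2 ∣_) (cong suc (sym xs≡1+ys))
      (∣m∣n⇒∣m+n (n∣n {2}) (go (rec shorter) (Unique-─ (AllPairs.tail u) σx∈xs)
        (InvolutionOn-─ u inv σx∈xs) (λ y∈ys → fpf (there (∈-─⁻ σx∈xs y∈ys)))))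
      where
      xs≡1+ys : length xs ≡ suc (length (xs ─ σx∈xs))
      xs≡1+ys = length-removeAt′ xs (index σx∈xs)

      shorter : length (xs ─ σx∈xs) < suc (length xs)
      shorter = subst (λ n → length (xs ─ σx∈xs) < suc n) (sym xs≡1+ys) (m<n⇒m<1+n (n<1+n _))

  oddLength⇒fixedPoint : DecidableEquality A → ∀ {σ} {L : List A} → Unique L →
                         InvolutionOn σ L → length L % 2 ≡ 1 → ∃[ x ] x ∈ L × σ x ≡ x
  oddLength⇒fixedPoint _≟_ {σ} {L} u inv odd with any? (λ x → σ x ≟ x) L
  ... | yes fixed = find fixed
  ... | no  none  = ⊥-elim (0≢1+n (trans (sym even) odd))
    where
    even : length L % 2 ≡ 0
    even = n∣m⇒m%n≡0 _ 2 (fixedPointFree⇒2∣length u inv λ x∈L σx≡x → none (lose x∈L σx≡x))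

x+z≡k⇒k∸x≡z : ∀ {d} {x z k : Vec ℕ d} → zipWith _+_ x z ≡ k → zipWith _∸_ k x ≡ z
x+z≡k⇒k∸x≡z {x = []}     {[]}     refl = refl
x+z≡k⇒k∸x≡z {x = x ∷ xs} {z ∷ zs} refl = cong₂ _∷_ (m+n∸m≡n x z) (x+z≡k⇒k∸x≡z refl)

x+z≡k⇒z+x≡k : ∀ {d} {x z k : Vec ℕ d} → zipWith _+_ x z ≡ k → zipWith _+_ z x ≡ k
x+z≡k⇒z+x≡k {x = x} {z} = trans (zipWith-comm +-comm z x)

x+x≡k⇒2x≡k : ∀ {d} {x k : Vec ℕ d} → zipWith _+_ x x ≡ k → ∀ j → 2 * lookup x j ≡ lookup k j
x+x≡k⇒2x≡k {x = x} refl j = begin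
  2 * lookup x j             ≡⟨ cong (lookup x j +_) (+-identityʳ _) ⟩
  lookup x j + lookup x j    ≡⟨ sym (lookup-zipWith _+_ j x x) ⟩
  lookup (zipWith _+_ x x) j ∎
  where open ≡-Reasoning

-- Truncated subtraction, but exact on I_C(k), where x + z = k for some z.
reflect : ∀ {d} → Vec ℕ d → Vec ℕ d → Vec ℕ d
reflect k x = zipWith _∸_ k x

module _ {d m} (A : Fin m → Vec ℕ d) {k : Vec ℕ d} where

  reflect-InI : ∀ {x} → InI A k x → InI A k (reflect k x)
  reflect-InI {x} (x∈C , z , z∈C , x+z≡k) =
    subst (InI A k) (sym (x+z≡k⇒k∸x≡z x+z≡k)) (z∈C , x , x∈C , x+z≡k⇒z+x≡k x+z≡k)

  reflect-involutive : ∀ {x} → InI A k x → reflect k (reflect k x) ≡ x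
  reflect-involutive (_ , _ , _ , x+z≡k) =
    trans (cong (reflect k) (x+z≡k⇒k∸x≡z x+z≡k)) (x+z≡k⇒k∸x≡z (x+z≡k⇒z+x≡k x+z≡k))

  reflect-fixed⇒2x≡k : ∀ {x} → InI A k x → reflect k x ≡ x → ∀ j → 2 * lookup x j ≡ lookup k j
  reflect-fixed⇒2x≡k {x} (_ , z , _ , x+z≡k) fixed =
    x+x≡k⇒2x≡k (subst (λ w → zipWith _+_ x w ≡ k) (trans (sym (x+z≡k⇒k∸x≡z x+z≡k)) fixed) x+z≡k)

lemma4p3 : (d m : ℕ) (A : Fin m → Vec ℕ d) (k : Vec ℕ d) → InCone A k →
           (L : List (Vec ℕ d)) → Unique L → (∀ x → (x ∈ L) ⇔ InI A k x) →
           length L % 2 ≡ 1 →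
           Σ (Vec ℕ d) λ h → (∀ j → 2 * lookup h j ≡ lookup k j) × InCone A h
lemma4p3 _ _ A k _ L unique L≡I odd =
  let x , x∈L , fixed = oddLength⇒fixedPoint (≡-dec _≟_) unique reflect-InvolutionOn odd
      x∈I = to (L≡I x) x∈L
  in  x , reflect-fixed⇒2x≡k A x∈I fixed , proj₁ x∈I
  where
  open Equivalence

  reflect-InvolutionOn : InvolutionOn (reflect k) L
  reflect-InvolutionOn = record
    { closed     = λ {x} x∈L → from (L≡I (reflect k x)) (reflect-InI A (to (L≡I x) x∈L))
    ; involutive = λ {x} x∈L → reflect-involutive A (to (L≡I x) x∈L)
    }
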